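{- Every two-dimensional face of $ASM_n$ is a quadrilateral (4-gon) or a triangle (3-gon).
   Context: An $n\times n$ alternating sign matrix (ASM) is a matrix with entries in $\{0,1,-1\}$ whose rows and columns each sum to $1$ and in which the nonzero entries of each row and of each column alternate in sign. $ASM_n\subset\mathbb{R}^{n\times n}$ is the convex hull of all $n\times n$ ASMs.
   Formalization: Only faces of $ASM_n$ cut out by linear functionals with rational coefficients are treated, with ℚ^(n×n) in place of $\mathbb{R}^{n\times n}$ as the ambient space for dimension. -}

module Defs where

open import Data.Nat using (ℕ)
open import Data.Fin using (Fin; _<_)
open import Data.Integer as ℤ using (ℤ; +_; -[1+_])
open import Data.Rational as ℚ using (ℚ; 0ℚ; _/_)
open import Data.Vec using (Vec; lookup; map; zipWith; foldr)
open import Data.Product using (Σ; _×_; ∃; _,_)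
open import Data.Sum using (_⊎_)
open import Relation.Binary.PropositionalEquality using (_≡_; _≢_)

Mat : Set → ℕ → Set
Mat A n = Vec (Vec A n) n

entry : ∀ {A n} → Mat A n → Fin n → Fin n → A
entry M i j = lookup (lookup M i) j

sumℤ : ∀ {k} → Vec ℤ k → ℤ
sumℤ = foldr _ ℤ._+_ (+ 0)

sumℚ : ∀ {k} → Vec ℚ k → ℚ
sumℚ = foldr _ ℚ._+_ 0ℚ

rowSum : ∀ {n} → Mat ℤ n → Fin n → ℤ
rowSum M i = sumℤ (lookup M i)

colSum : ∀ {n} → Mat ℤ n → Fin n → ℤ
colSum M j = sumℤ (map (λ r → lookup r j) M)

Alternating : ∀ {n} → (Fin n → ℤ) → Set
Alternating {n} f =
  (j k : Fin n) → j < k → f j ≢ + 0 → f k ≢ + 0 →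
  ((l : Fin n) → j < l → l < k → f l ≡ + 0) →
  f j ≡ ℤ.- f k

record IsASM {n : ℕ} (M : Mat ℤ n) : Set where
  field
    entries  : (i j : Fin n) → (entry M i j ≡ + 0) ⊎ ((entry M i j ≡ + 1) ⊎ (entry M i j ≡ -[1+ 0 ]))
    rowSum1  : (i : Fin n) → rowSum M i ≡ + 1
    colSum1  : (j : Fin n) → colSum M j ≡ + 1
    rowAlt   : (i : Fin n) → Alternating (λ j → entry M i j)
    colAlt   : (j : Fin n) → Alternating (λ i → entry M i j)

toℚ : ∀ {n} → Mat ℤ n → Mat ℚ n
toℚ = map (map (λ z → z / 1))

_⊕_ : ∀ {n} → Mat ℚ n → Mat ℚ n → Mat ℚ n
_⊕_ = zipWith (zipWith ℚ._+_)

_⊖_ : ∀ {n} → Mat ℚ n → Mat ℚ n → Mat ℚ n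
_⊖_ = zipWith (zipWith ℚ._-_)

_·_ : ∀ {n} → ℚ → Mat ℚ n → Mat ℚ n
r · M = map (map (r ℚ.*_)) M

zeroM : ∀ {n} → Mat ℚ n
zeroM = Data.Vec.replicate _ (Data.Vec.replicate _ 0ℚ)

⟨_,_⟩ : ∀ {n} → Mat ℚ n → Mat ℚ n → ℚ
⟨ c , x ⟩ = sumℚ (zipWith (λ r s → sumℚ (zipWith ℚ._*_ r s)) c x)

-- the vertices of ASM_n (= the ASMs) lying in the face of ASM_n
-- exposed by the linear functional c (i.e. maximising <c,-> over ASM_n)
InFace : ∀ {n} → Mat ℚ n → Mat ℤ n → Set
InFace c A = IsASM A × ((B : Mat ℤ _) → IsASM B → ⟨ c , toℚ B ⟩ ℚ.≤ ⟨ c , toℚ A ⟩)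

LinIndep₂ : ∀ {n} → Mat ℚ n → Mat ℚ n → Set
LinIndep₂ u v = (λ₁ λ₂ : ℚ) → (λ₁ · u) ⊕ (λ₂ · v) ≡ zeroM → (λ₁ ≡ 0ℚ) × (λ₂ ≡ 0ℚ)

-- the point set P has 2-dimensional affine hull
AffDim2 : ∀ {n} → (Mat ℤ n → Set) → Set
AffDim2 {n} P =
  Σ (Mat ℤ n) λ a → Σ (Mat ℤ n) λ b → Σ (Mat ℤ n) λ d →
    P a × P b × P d ×
    LinIndep₂ (toℚ b ⊖ toℚ a) (toℚ d ⊖ toℚ a) ×
    ((x : Mat ℤ n) → P x → ∃ λ λ₁ → ∃ λ λ₂ →
        (toℚ x ⊖ toℚ a) ≡ (λ₁ · (toℚ b ⊖ toℚ a)) ⊕ (λ₂ · (toℚ d ⊖ toℚ a)))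

-- The partial row sums σ(x)ᵢⱼ = xᵢ₀ + ⋯ + xᵢⱼ of an ASM are all 0 or 1, since the nonzero
-- entries of a row alternate in sign and add up to 1; and x ↦ σ(x) is linear and injective.
-- A 2-dimensional face lies in a plane a + ℚ(b − a) + ℚ(d − a) spanned by three of its
-- vertices.  Choosing positions p, q where the 2×2 minor of σ(b − a), σ(d − a) is nonzero,
-- x ↦ (σ(x)ₚ , σ(x)_q) is injective on that plane and maps the vertices of the face to
-- corners of the unit square, so the face has at most four vertices.  The corners of a, b, d
-- leave one corner free, and the only point of the plane mapped to it is the integral point
-- z = a ± (b − a) ± (d − a); so the face consists of a, b, d and, when z is an ASM, z.

module Submission where

open import Level using (0ℓ)
open import Function using (_∘_)
open import Function.Bundles using (_⇔_; mk⇔)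
open import Data.Empty using (⊥-elim)
open import Data.Product as Product using (Σ; ∃; ∃₂; _×_; _,_; proj₁; proj₂)
import Data.Product.Properties as ProductP
open import Data.Sum as Sum using (_⊎_; inj₁; inj₂)
open import Relation.Binary.PropositionalEquality
open import Relation.Nullary using (Dec; yes; no; ¬?; contradiction)
import Relation.Nullary.Decidable as Dec
open import Relation.Nullary.Decidable using (_×-dec_; _⊎-dec_; _→-dec_)
open import Relation.Unary using (Pred; Decidable)
import Algebra.Definitions as AlgebraDefinitions
open import Data.Nat as ℕ using (ℕ; z≤n; s≤s)
open import Data.Fin as Fin using (Fin; zero; suc; fromℕ)
import Data.Fin.Properties as FinP
open import Data.Integer as ℤ using (ℤ; +_; -[1+_])
import Data.Integer.Properties as ℤP
open import Data.Rational as ℚ using (ℚ; 0ℚ; 1ℚ; _/_)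
import Data.Rational.Properties as ℚP
open import Data.Rational.Solver using (module +-*-Solver)
open import Data.Rational.Unnormalised as ℚᵘ using (mkℚᵘ; *≡*)
import Data.Rational.Unnormalised.Properties as ℚᵘP
open import Data.Vec as Vec using (Vec; []; _∷_; lookup; zipWith)
import Data.Vec.Properties as VecP
open import Data.List as List using (List; []; _∷_; length)
open import Data.List.Membership.Propositional using (_∈_)
open import Data.List.Membership.Propositional.Properties using (∈-map⁻)
open import Data.List.Relation.Unary.All as All using (All; []; _∷_)
open import Data.List.Relation.Unary.AllPairs using ([]; _∷_)
open import Data.List.Relation.Unary.Any as Any using (Any; here; there)
open import Data.List.Relation.Unary.Unique.Propositional using (Unique)
import Data.List.Relation.Unary.Unique.Propositional.Properties as UniqueP

open import Defs

open +-*-Solver using (solve; _:=_; _:+_; _:*_; _:-_; :-_; con)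

-- Integers as rationals, and affine combinations

ι : ℤ → ℚ
ι z = z / 1

ι-injective : ∀ {x y} → ι x ≡ ι y → x ≡ y
ι-injective {x} {y} eq =
  ℤP.*-cancelʳ-≡ x y (+ 1) (ℚᵘP.drop-*≡* (ℚP.fromℚᵘ-injective {mkℚᵘ x 0} {mkℚᵘ y 0} eq))

module _ where
  open ℚᵘP.≃-Reasoning

  toℚᵘ-ι : ∀ x → ℚ.toℚᵘ (ι x) ℚᵘ.≃ mkℚᵘ x 0
  toℚᵘ-ι x = ℚP.toℚᵘ-fromℚᵘ (mkℚᵘ x 0)

  ι-+ : ∀ x y → ι (x ℤ.+ y) ≡ ι x ℚ.+ ι y
  ι-+ x y = ℚP.toℚᵘ-injective (begin
    ℚ.toℚᵘ (ι (x ℤ.+ y))              ≈⟨ toℚᵘ-ι (x ℤ.+ y) ⟩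
    mkℚᵘ (x ℤ.+ y) 0                  ≈⟨ *≡* (cong (ℤ._* + 1) (sym x*1+y*1≡x+y)) ⟩
    mkℚᵘ x 0 ℚᵘ.+ mkℚᵘ y 0            ≈⟨ ℚᵘP.+-cong (ℚᵘP.≃-sym (toℚᵘ-ι x)) (ℚᵘP.≃-sym (toℚᵘ-ι y)) ⟩
    ℚ.toℚᵘ (ι x) ℚᵘ.+ ℚ.toℚᵘ (ι y)    ≈⟨ ℚᵘP.≃-sym (ℚP.toℚᵘ-homo-+ (ι x) (ι y)) ⟩
    ℚ.toℚᵘ (ι x ℚ.+ ι y)              ∎)
    where
    x*1+y*1≡x+y : x ℤ.* + 1 ℤ.+ y ℤ.* + 1 ≡ x ℤ.+ y
    x*1+y*1≡x+y = cong₂ ℤ._+_ (ℤP.*-identityʳ x) (ℤP.*-identityʳ y)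

  ι-* : ∀ x y → ι (x ℤ.* y) ≡ ι x ℚ.* ι y
  ι-* x y = ℚP.toℚᵘ-injective (begin
    ℚ.toℚᵘ (ι (x ℤ.* y))              ≈⟨ toℚᵘ-ι (x ℤ.* y) ⟩
    mkℚᵘ x 0 ℚᵘ.* mkℚᵘ y 0            ≈⟨ ℚᵘP.*-cong (ℚᵘP.≃-sym (toℚᵘ-ι x)) (ℚᵘP.≃-sym (toℚᵘ-ι y)) ⟩
    ℚ.toℚᵘ (ι x) ℚᵘ.* ℚ.toℚᵘ (ι y)    ≈⟨ ℚᵘP.≃-sym (ℚP.toℚᵘ-homo-* (ι x) (ι y)) ⟩
    ℚ.toℚᵘ (ι x ℚ.* ι y)              ∎)

  ι-neg : ∀ x → ι (ℤ.- x) ≡ ℚ.- ι x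
  ι-neg x = ℚP.toℚᵘ-injective (begin
    ℚ.toℚᵘ (ι (ℤ.- x))                ≈⟨ toℚᵘ-ι (ℤ.- x) ⟩
    ℚᵘ.- mkℚᵘ x 0                     ≈⟨ ℚᵘP.-‿cong (ℚᵘP.≃-sym (toℚᵘ-ι x)) ⟩
    ℚᵘ.- ℚ.toℚᵘ (ι x)                 ≈⟨ ℚᵘP.≃-sym (ℚP.toℚᵘ-homo‿- (ι x)) ⟩
    ℚ.toℚᵘ (ℚ.- ι x)                  ∎)

ι-- : ∀ x y → ι (x ℤ.- y) ≡ ι x ℚ.- ι y
ι-- x y = trans (ι-+ x (ℤ.- y)) (cong (ι x ℚ.+_) (ι-neg y))

affineℤ : ℤ → ℤ → ℤ → ℤ → ℤ → ℤ
affineℤ s t a b d = a ℤ.+ (s ℤ.* (b ℤ.- a) ℤ.+ t ℤ.* (d ℤ.- a))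

affine : ℚ → ℚ → ℚ → ℚ → ℚ → ℚ
affine λ₁ λ₂ a b d = a ℚ.+ (λ₁ ℚ.* (b ℚ.- a) ℚ.+ λ₂ ℚ.* (d ℚ.- a))

ι-affine : ∀ s t a b d → ι (affineℤ s t a b d) ≡ affine (ι s) (ι t) (ι a) (ι b) (ι d)
ι-affine s t a b d = begin
  ι (a ℤ.+ (s ℤ.* (b ℤ.- a) ℤ.+ t ℤ.* (d ℤ.- a)))
    ≡⟨ ι-+ a _ ⟩
  ι a ℚ.+ ι (s ℤ.* (b ℤ.- a) ℤ.+ t ℤ.* (d ℤ.- a))
    ≡⟨ cong (ι a ℚ.+_) (ι-+ (s ℤ.* (b ℤ.- a)) _) ⟩
  ι a ℚ.+ (ι (s ℤ.* (b ℤ.- a)) ℚ.+ ι (t ℤ.* (d ℤ.- a)))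
    ≡⟨ cong (ι a ℚ.+_) (cong₂ ℚ._+_ (ι-* s _) (ι-* t _)) ⟩
  ι a ℚ.+ (ι s ℚ.* ι (b ℤ.- a) ℚ.+ ι t ℚ.* ι (d ℤ.- a))
    ≡⟨ cong (ι a ℚ.+_) (cong₂ ℚ._+_ (cong (ι s ℚ.*_) (ι-- b a)) (cong (ι t ℚ.*_) (ι-- d a))) ⟩
  affine (ι s) (ι t) (ι a) (ι b) (ι d)
    ∎
  where open ≡-Reasoning

affine-+ : ∀ λ₁ λ₂ a b d a′ b′ d′ →
  affine λ₁ λ₂ a b d ℚ.+ affine λ₁ λ₂ a′ b′ d′ ≡ affine λ₁ λ₂ (a ℚ.+ a′) (b ℚ.+ b′) (d ℚ.+ d′)
affine-+ = solve 8 (λ λ₁ λ₂ a b d a′ b′ d′ →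
  (a :+ (λ₁ :* (b :- a) :+ λ₂ :* (d :- a))) :+ (a′ :+ (λ₁ :* (b′ :- a′) :+ λ₂ :* (d′ :- a′)))
  := (a :+ a′) :+ (λ₁ :* ((b :+ b′) :- (a :+ a′)) :+ λ₂ :* ((d :+ d′) :- (a :+ a′)))) refl

affine-* : ∀ λ₁ λ₂ c a b d → c ℚ.* affine λ₁ λ₂ a b d ≡ affine λ₁ λ₂ (c ℚ.* a) (c ℚ.* b) (c ℚ.* d)
affine-* = solve 6 (λ λ₁ λ₂ c a b d →
  c :* (a :+ (λ₁ :* (b :- a) :+ λ₂ :* (d :- a)))
  := c :* a :+ (λ₁ :* (c :* b :- c :* a) :+ λ₂ :* (c :* d :- c :* a))) refl

affine-cong : ∀ λ₁ λ₂ {a a′ b b′ d d′} → a ≡ a′ → b ≡ b′ → d ≡ d′ →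
              affine λ₁ λ₂ a b d ≡ affine λ₁ λ₂ a′ b′ d′
affine-cong λ₁ λ₂ refl refl refl = refl

affine-origin : ∀ a b d → affine 0ℚ 0ℚ a b d ≡ a
affine-origin = solve 3 (λ a b d → a :+ (con 0ℚ :* (b :- a) :+ con 0ℚ :* (d :- a)) := a) refl

affine-first : ∀ a b d → affine 1ℚ 0ℚ a b d ≡ b
affine-first = solve 3 (λ a b d → a :+ (con 1ℚ :* (b :- a) :+ con 0ℚ :* (d :- a)) := b) refl

affine-second : ∀ a b d → affine 0ℚ 1ℚ a b d ≡ d
affine-second = solve 3 (λ a b d → a :+ (con 0ℚ :* (b :- a) :+ con 1ℚ :* (d :- a)) := d) refl

affine-const : ∀ λ₁ λ₂ a → affine λ₁ λ₂ a a a ≡ a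
affine-const = solve 3 (λ λ₁ λ₂ a → a :+ (λ₁ :* (a :- a) :+ λ₂ :* (a :- a)) := a) refl

affine-shift : ∀ λ₁ λ₂ μ₁ μ₂ a b d →
  affine λ₁ λ₂ a b d ≡ affine μ₁ μ₂ a b d ℚ.+ ((λ₁ ℚ.- μ₁) ℚ.* (b ℚ.- a) ℚ.+ (λ₂ ℚ.- μ₂) ℚ.* (d ℚ.- a))
affine-shift = solve 7 (λ λ₁ λ₂ μ₁ μ₂ a b d →
  a :+ (λ₁ :* (b :- a) :+ λ₂ :* (d :- a))
  := (a :+ (μ₁ :* (b :- a) :+ μ₂ :* (d :- a))) :+ ((λ₁ :- μ₁) :* (b :- a) :+ (λ₂ :- μ₂) :* (d :- a))) refl

-- Linear algebra in two unknowns

p*q≡0⇒p≡0 : ∀ {p q} → q ≢ 0ℚ → p ℚ.* q ≡ 0ℚ → p ≡ 0ℚ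
p*q≡0⇒p≡0 {p} {q} q≢0 pq≡0 = begin
  p                         ≡⟨ sym (ℚP.*-identityʳ p) ⟩
  p ℚ.* 1ℚ                  ≡⟨ cong (p ℚ.*_) (sym (ℚP.*-inverseʳ q)) ⟩
  p ℚ.* (q ℚ.* ℚ.1/ q)      ≡⟨ sym (ℚP.*-assoc p q _) ⟩
  (p ℚ.* q) ℚ.* ℚ.1/ q      ≡⟨ cong (ℚ._* _) pq≡0 ⟩
  0ℚ ℚ.* ℚ.1/ q             ≡⟨ ℚP.*-zeroˡ (ℚ.1/ q) ⟩
  0ℚ                        ∎
  where
  open ≡-Reasoning
  instance _ = ℚ.≢-nonZero q≢0

det≢0⇒trivial-solution : ∀ {u₁ v₁ u₂ v₂ α β} → u₁ ℚ.* v₂ ℚ.- u₂ ℚ.* v₁ ≢ 0ℚ →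
  α ℚ.* u₁ ℚ.+ β ℚ.* v₁ ≡ 0ℚ → α ℚ.* u₂ ℚ.+ β ℚ.* v₂ ≡ 0ℚ → α ≡ 0ℚ × β ≡ 0ℚ
det≢0⇒trivial-solution {u₁} {v₁} {u₂} {v₂} {α} {β} det≢0 eq₁ eq₂ =
    p*q≡0⇒p≡0 det≢0 (begin
      α ℚ.* (u₁ ℚ.* v₂ ℚ.- u₂ ℚ.* v₁)
        ≡⟨ eliminate-β α β u₁ v₁ u₂ v₂ ⟩
      v₂ ℚ.* (α ℚ.* u₁ ℚ.+ β ℚ.* v₁) ℚ.- v₁ ℚ.* (α ℚ.* u₂ ℚ.+ β ℚ.* v₂)
        ≡⟨ cong₂ (λ x y → v₂ ℚ.* x ℚ.- v₁ ℚ.* y) eq₁ eq₂ ⟩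
      v₂ ℚ.* 0ℚ ℚ.- v₁ ℚ.* 0ℚ
        ≡⟨ cong₂ ℚ._-_ (ℚP.*-zeroʳ v₂) (ℚP.*-zeroʳ v₁) ⟩
      0ℚ
        ∎)
  , p*q≡0⇒p≡0 det≢0 (begin
      β ℚ.* (u₁ ℚ.* v₂ ℚ.- u₂ ℚ.* v₁)
        ≡⟨ eliminate-α α β u₁ v₁ u₂ v₂ ⟩
      u₁ ℚ.* (α ℚ.* u₂ ℚ.+ β ℚ.* v₂) ℚ.- u₂ ℚ.* (α ℚ.* u₁ ℚ.+ β ℚ.* v₁)
        ≡⟨ cong₂ (λ x y → u₁ ℚ.* x ℚ.- u₂ ℚ.* y) eq₂ eq₁ ⟩
      u₁ ℚ.* 0ℚ ℚ.- u₂ ℚ.* 0ℚ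
        ≡⟨ cong₂ ℚ._-_ (ℚP.*-zeroʳ u₁) (ℚP.*-zeroʳ u₂) ⟩
      0ℚ
        ∎)
  where
  open ≡-Reasoning
  eliminate-β : ∀ α β u₁ v₁ u₂ v₂ →
    α ℚ.* (u₁ ℚ.* v₂ ℚ.- u₂ ℚ.* v₁) ≡ v₂ ℚ.* (α ℚ.* u₁ ℚ.+ β ℚ.* v₁) ℚ.- v₁ ℚ.* (α ℚ.* u₂ ℚ.+ β ℚ.* v₂)
  eliminate-β = solve 6 (λ α β u₁ v₁ u₂ v₂ →
    α :* (u₁ :* v₂ :- u₂ :* v₁) := v₂ :* (α :* u₁ :+ β :* v₁) :- v₁ :* (α :* u₂ :+ β :* v₂)) refl
  eliminate-α : ∀ α β u₁ v₁ u₂ v₂ →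
    β ℚ.* (u₁ ℚ.* v₂ ℚ.- u₂ ℚ.* v₁) ≡ u₁ ℚ.* (α ℚ.* u₂ ℚ.+ β ℚ.* v₂) ℚ.- u₂ ℚ.* (α ℚ.* u₁ ℚ.+ β ℚ.* v₁)
  eliminate-α = solve 6 (λ α β u₁ v₁ u₂ v₂ →
    β :* (u₁ :* v₂ :- u₂ :* v₁) := u₁ :* (α :* u₂ :+ β :* v₂) :- u₂ :* (α :* u₁ :+ β :* v₁)) refl

Searchable : Set → Set₁
Searchable I = ∀ {P : Pred I 0ℓ} → Decidable P → Dec (∃ P)

searchable-× : ∀ {I J} → Searchable I → Searchable J → Searchable (I × J)
searchable-× search-I search-J P? =
  Dec.map′ (λ (i , j , Pij) → (i , j) , Pij) (λ ((i , j) , Pij) → i , j , Pij)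
    (search-I λ i → search-J λ j → P? (i , j))

module _ {I : Set} where

  Independent : (I → ℚ) → (I → ℚ) → Set
  Independent u v = ∀ α β → (∀ i → α ℚ.* u i ℚ.+ β ℚ.* v i ≡ 0ℚ) → α ≡ 0ℚ × β ≡ 0ℚ

  minor : (I → ℚ) → (I → ℚ) → I → I → ℚ
  minor u v p q = u p ℚ.* v q ℚ.- u q ℚ.* v p

  -- Opaque, like squareCompletion below: the witnesses are used only through their
  -- specification, and unfolding the search in later conversion checks is prohibitively slow.
  opaque
    independent⇒nonzero-minor : Searchable I → ∀ {u v} → Independent u v → ∃₂ λ p q → minor u v p q ≢ 0ℚ
    independent⇒nonzero-minor search {u} {v} indep with search (λ p → ¬? (u p ℚ.≟ 0ℚ))
    ... | no ∄p = ⊥-elim (ℚP.1≢0 (proj₁ (indep 1ℚ 0ℚ λ i → trans (1x+0y≡x (u i) (v i)) (u≡0 i))))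
      where
      u≡0 : ∀ i → u i ≡ 0ℚ
      u≡0 i = Dec.decidable-stable (u i ℚ.≟ 0ℚ) (λ ui≢0 → ∄p (i , ui≢0))
      1x+0y≡x : ∀ x y → 1ℚ ℚ.* x ℚ.+ 0ℚ ℚ.* y ≡ x
      1x+0y≡x = solve 2 (λ x y → con 1ℚ :* x :+ con 0ℚ :* y := x) refl
    ... | yes (p , up≢0) with search (λ q → ¬? (minor u v p q ℚ.≟ 0ℚ))
    ...   | yes (q , minor≢0) = p , q , minor≢0
    ...   | no ∄q = ⊥-elim (up≢0 (proj₂ (indep (ℚ.- v p) (u p) λ q →
              trans (expand (u p) (v p) (u q) (v q)) (singular q))))
      where
      singular : ∀ q → minor u v p q ≡ 0ℚ
      singular q = Dec.decidable-stable (minor u v p q ℚ.≟ 0ℚ) (λ m≢0 → ∄q (q , m≢0))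
      expand : ∀ up vp uq vq → (ℚ.- vp) ℚ.* uq ℚ.+ up ℚ.* vq ≡ up ℚ.* vq ℚ.- uq ℚ.* vp
      expand = solve 4 (λ up vp uq vq → (:- vp) :* uq :+ up :* vq := up :* vq :- uq :* vp) refl

-- Prefix sums

module _ {A : Set} (_∙_ : A → A → A) where

  prefixSum : ∀ {m} → (Fin m → A) → Fin m → A
  prefixSum f zero    = f zero
  prefixSum f (suc j) = f zero ∙ prefixSum (f ∘ suc) j

  prefixSum-cong : ∀ {m} {f g : Fin m → A} → (∀ k → f k ≡ g k) → ∀ j → prefixSum f j ≡ prefixSum g j
  prefixSum-cong eq zero    = eq zero
  prefixSum-cong eq (suc j) = cong₂ _∙_ (eq zero) (prefixSum-cong (eq ∘ suc) j)

  open AlgebraDefinitions {A = A} _≡_ using (LeftCancellative)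

  prefixSum-injective : LeftCancellative _∙_ → ∀ {m} {f g : Fin m → A} →
                        (∀ j → prefixSum f j ≡ prefixSum g j) → ∀ k → f k ≡ g k
  prefixSum-injective cancel eq zero    = eq zero
  prefixSum-injective cancel {f = f} {g} eq (suc k) = prefixSum-injective cancel tail-eq k
    where
    tail-eq : ∀ j → prefixSum (f ∘ suc) j ≡ prefixSum (g ∘ suc) j
    tail-eq j = cancel (g zero) _ _ (trans (cong (_∙ prefixSum (f ∘ suc) j) (sym (eq zero))) (eq (suc j)))

prefixSum-homo : ∀ {A B : Set} {_∙_ : A → A → A} {_◦_ : B → B → B} (h : A → B) →
                 (∀ x y → h (x ∙ y) ≡ h x ◦ h y) →
                 ∀ {m} (f : Fin m → A) j → prefixSum _◦_ (h ∘ f) j ≡ h (prefixSum _∙_ f j)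
prefixSum-homo h homo f zero    = refl
prefixSum-homo {_◦_ = _◦_} h homo f (suc j) =
  trans (cong (h (f zero) ◦_) (prefixSum-homo h homo (f ∘ suc) j)) (sym (homo (f zero) _))

prefixSum-affine : ∀ λ₁ λ₂ {m} {x a b d : Fin m → ℚ} →
  (∀ k → x k ≡ affine λ₁ λ₂ (a k) (b k) (d k)) →
  ∀ j → prefixSum ℚ._+_ x j ≡ affine λ₁ λ₂ (prefixSum ℚ._+_ a j) (prefixSum ℚ._+_ b j) (prefixSum ℚ._+_ d j)
prefixSum-affine λ₁ λ₂ eq zero    = eq zero
prefixSum-affine λ₁ λ₂ {a = a} {b} {d} eq (suc j) =
  trans (cong₂ ℚ._+_ (eq zero) (prefixSum-affine λ₁ λ₂ {a = a ∘ suc} {b ∘ suc} {d ∘ suc} (eq ∘ suc) j))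
        (affine-+ λ₁ λ₂ (a zero) (b zero) (d zero) _ _ _)

-- Partial row sums of alternating sign matrices

firstNonzero : ∀ {m} → (Fin m → ℤ) → ℤ
firstNonzero {ℕ.zero} f = + 0
firstNonzero {ℕ.suc m} f with f zero ℤ.≟ + 0
... | yes _ = firstNonzero (f ∘ suc)
... | no _  = f zero

firstNonzero-position : ∀ {m} (f : Fin m → ℤ) → firstNonzero f ≢ + 0 →
                        ∃ λ k → f k ≡ firstNonzero f × (∀ l → l Fin.< k → f l ≡ + 0)
firstNonzero-position {ℕ.zero} f first≢0 = ⊥-elim (first≢0 refl)
firstNonzero-position {ℕ.suc m} f first≢0 with f zero ℤ.≟ + 0
... | no _ = zero , refl , λ _ ()
... | yes f0≡0 with firstNonzero-position (f ∘ suc) first≢0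
...   | k , fk≡first , zeros = suc k , fk≡first , before
  where
  before : ∀ l → l Fin.< suc k → f l ≡ + 0
  before zero    _         = f0≡0
  before (suc l) (s≤s l<k) = zeros l l<k

module _ {m} {f : Fin (ℕ.suc m) → ℤ} (alt : Alternating f) where

  Alternating-tail : Alternating (f ∘ suc)
  Alternating-tail j k j<k fj≢0 fk≢0 between = alt (suc j) (suc k) (s≤s j<k) fj≢0 fk≢0 between′
    where
    between′ : ∀ l → suc j Fin.< l → l Fin.< suc k → f l ≡ + 0
    between′ (suc l) (s≤s j<l) (s≤s l<k) = between l j<l l<k

  Alternating-head : f zero ≢ + 0 → firstNonzero (f ∘ suc) ≢ + 0 → f zero ≡ ℤ.- firstNonzero (f ∘ suc)
  Alternating-head f0≢0 first≢0 with firstNonzero-position (f ∘ suc) first≢0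
  ... | k , fk≡first , zeros =
    trans (alt zero (suc k) (s≤s z≤n) f0≢0 (λ fk≡0 → first≢0 (trans (sym fk≡first) fk≡0)) between)
          (cong ℤ.-_ fk≡first)
    where
    between : ∀ l → zero {ℕ.suc m} Fin.< l → l Fin.< suc k → f l ≡ + 0
    between (suc l) _ (s≤s l<k) = zeros l l<k

prefixSum-alternating : ∀ {m} {f : Fin m → ℤ} → Alternating f →
                        ∀ j → prefixSum ℤ._+_ f j ≡ + 0 ⊎ prefixSum ℤ._+_ f j ≡ firstNonzero f
prefixSum-alternating {ℕ.suc m} {f} alt j with f zero ℤ.≟ + 0
prefixSum-alternating {ℕ.suc m} {f} alt zero    | yes f0≡0 = inj₁ f0≡0
prefixSum-alternating {ℕ.suc m} {f} alt (suc j) | yes f0≡0 =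
  Sum.map (trans drop-head) (trans drop-head) (prefixSum-alternating (Alternating-tail alt) j)
  where
  drop-head : f zero ℤ.+ prefixSum ℤ._+_ (f ∘ suc) j ≡ prefixSum ℤ._+_ (f ∘ suc) j
  drop-head = trans (cong (ℤ._+ prefixSum ℤ._+_ (f ∘ suc) j) f0≡0) (ℤP.+-identityˡ _)
prefixSum-alternating {ℕ.suc m} {f} alt zero    | no f0≢0 = inj₂ refl
prefixSum-alternating {ℕ.suc m} {f} alt (suc j) | no f0≢0
  with prefixSum-alternating (Alternating-tail alt) j | firstNonzero (f ∘ suc) ℤ.≟ + 0
... | inj₁ rest≡0     | _ = inj₂ (trans (cong (ℤ._+_ (f zero)) rest≡0) (ℤP.+-identityʳ _))
... | inj₂ rest≡first | yes first≡0 =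
  inj₂ (trans (cong (ℤ._+_ (f zero)) (trans rest≡first first≡0)) (ℤP.+-identityʳ _))
... | inj₂ rest≡first | no first≢0 = inj₁ (begin
  f zero ℤ.+ prefixSum ℤ._+_ (f ∘ suc) j
    ≡⟨ cong₂ ℤ._+_ (Alternating-head alt f0≢0 first≢0) rest≡first ⟩
  ℤ.- firstNonzero (f ∘ suc) ℤ.+ firstNonzero (f ∘ suc)
    ≡⟨ ℤP.+-inverseˡ (firstNonzero (f ∘ suc)) ⟩
  + 0
    ∎)
  where open ≡-Reasoning

sumℤ≡prefixSum-last : ∀ {m} (xs : Vec ℤ (ℕ.suc m)) → sumℤ xs ≡ prefixSum ℤ._+_ (lookup xs) (fromℕ m)
sumℤ≡prefixSum-last (x ∷ [])     = ℤP.+-identityʳ x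
sumℤ≡prefixSum-last (x ∷ y ∷ ys) = cong (ℤ._+_ x) (sumℤ≡prefixSum-last (y ∷ ys))

Binary : ℤ → Set
Binary z = z ≡ + 0 ⊎ z ≡ + 1

prefixSum-binary : ∀ {m} (xs : Vec ℤ m) → Alternating (lookup xs) → sumℤ xs ≡ + 1 →
                   ∀ j → Binary (prefixSum ℤ._+_ (lookup xs) j)
prefixSum-binary {ℕ.suc m} xs alt sum≡1 j =
  Sum.map₂ (λ s≡first → trans s≡first firstNonzero≡1) (prefixSum-alternating alt j)
  where
  firstNonzero≡1 : firstNonzero (lookup xs) ≡ + 1
  firstNonzero≡1 with prefixSum-alternating alt (fromℕ m)
  ... | inj₁ last≡0     = contradiction (trans (sym sum≡1) (trans (sumℤ≡prefixSum-last xs) last≡0)) λ ()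
  ... | inj₂ last≡first = trans (sym last≡first) (trans (sym (sumℤ≡prefixSum-last xs)) sum≡1)

Pos : ℕ → Set
Pos n = Fin n × Fin n

rowPartialSum : ∀ {n} → Mat ℤ n → Pos n → ℤ
rowPartialSum M (i , j) = prefixSum ℤ._+_ (entry M i) j

rowPartialSum-binary : ∀ {n} {M : Mat ℤ n} → IsASM M → ∀ r → Binary (rowPartialSum M r)
rowPartialSum-binary {M = M} asm (i , j) = prefixSum-binary (lookup M i) (rowAlt i) (rowSum1 i) j
  where open IsASM asm

alternating? : ∀ {m} (f : Fin m → ℤ) → Dec (Alternating f)
alternating? f =
  FinP.all? λ j → FinP.all? λ k → j FinP.<? k →-dec ¬? (f j ℤ.≟ + 0) →-dec ¬? (f k ℤ.≟ + 0) →-dec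
    (FinP.all? λ l → j FinP.<? l →-dec l FinP.<? k →-dec f l ℤ.≟ + 0) →-dec f j ℤ.≟ ℤ.- f k

isASM? : ∀ {n} (M : Mat ℤ n) → Dec (IsASM M)
isASM? M = Dec.map′
  (λ (entries , rowSum1 , colSum1 , rowAlt , colAlt) → record
     { entries = entries ; rowSum1 = rowSum1 ; colSum1 = colSum1 ; rowAlt = rowAlt ; colAlt = colAlt })
  (λ asm → let open IsASM asm in entries , rowSum1 , colSum1 , rowAlt , colAlt)
  (  (FinP.all? λ i → FinP.all? λ j →
        entry M i j ℤ.≟ + 0 ⊎-dec entry M i j ℤ.≟ + 1 ⊎-dec entry M i j ℤ.≟ -[1+ 0 ])
   ×-dec (FinP.all? λ i → rowSum M i ℤ.≟ + 1)
   ×-dec (FinP.all? λ j → colSum M j ℤ.≟ + 1)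
   ×-dec (FinP.all? λ i → alternating? (entry M i))
   ×-dec (FinP.all? λ j → alternating? (λ i → entry M i j)))

-- Matrices and the pairing ⟨_,_⟩

module _ {n : ℕ} where

  entry-map : ∀ {A B : Set} (f : A → B) (M : Mat A n) i j → entry (Vec.map (Vec.map f) M) i j ≡ f (entry M i j)
  entry-map f M i j =
    trans (cong (λ row → lookup row j) (VecP.lookup-map i _ M)) (VecP.lookup-map j f (lookup M i))

  entry-zipWith : ∀ {A B C : Set} (f : A → B → C) (X : Mat A n) (Y : Mat B n) i j →
                  entry (zipWith (zipWith f) X Y) i j ≡ f (entry X i j) (entry Y i j)
  entry-zipWith f X Y i j =
    trans (cong (λ row → lookup row j) (VecP.lookup-zipWith _ i X Y))
          (VecP.lookup-zipWith f j (lookup X i) (lookup Y i))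

  entry-toℚ : ∀ (M : Mat ℤ n) i j → entry (toℚ M) i j ≡ ι (entry M i j)
  entry-toℚ = entry-map ι

  entry-zeroM : ∀ i j → entry (zeroM {n}) i j ≡ 0ℚ
  entry-zeroM i j =
    trans (cong (λ row → lookup row j) (VecP.lookup-replicate i _)) (VecP.lookup-replicate j _)

  entry-combination : ∀ λ₁ λ₂ (A B D : Mat ℚ n) i j →
    entry ((λ₁ · (B ⊖ A)) ⊕ (λ₂ · (D ⊖ A))) i j ≡
    λ₁ ℚ.* (entry B i j ℚ.- entry A i j) ℚ.+ λ₂ ℚ.* (entry D i j ℚ.- entry A i j)
  entry-combination λ₁ λ₂ A B D i j = begin
    entry ((λ₁ · (B ⊖ A)) ⊕ (λ₂ · (D ⊖ A))) i j
      ≡⟨ entry-zipWith ℚ._+_ (λ₁ · (B ⊖ A)) (λ₂ · (D ⊖ A)) i j ⟩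
    entry (λ₁ · (B ⊖ A)) i j ℚ.+ entry (λ₂ · (D ⊖ A)) i j
      ≡⟨ cong₂ ℚ._+_ (entry-map (λ₁ ℚ.*_) (B ⊖ A) i j) (entry-map (λ₂ ℚ.*_) (D ⊖ A) i j) ⟩
    λ₁ ℚ.* entry (B ⊖ A) i j ℚ.+ λ₂ ℚ.* entry (D ⊖ A) i j
      ≡⟨ cong₂ (λ x y → λ₁ ℚ.* x ℚ.+ λ₂ ℚ.* y) (entry-zipWith ℚ._-_ B A i j) (entry-zipWith ℚ._-_ D A i j) ⟩
    λ₁ ℚ.* (entry B i j ℚ.- entry A i j) ℚ.+ λ₂ ℚ.* (entry D i j ℚ.- entry A i j)
      ∎
    where open ≡-Reasoning

  matrix : ∀ {A : Set} → (Fin n → Fin n → A) → Mat A n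
  matrix f = Vec.tabulate λ i → Vec.tabulate (f i)

  entry-matrix : ∀ {A : Set} (f : Fin n → Fin n → A) i j → entry (matrix f) i j ≡ f i j
  entry-matrix f i j =
    trans (cong (λ row → lookup row j) (VecP.lookup∘tabulate (λ i → Vec.tabulate (f i)) i))
          (VecP.lookup∘tabulate (f i) j)

  Mat-ext : ∀ {A : Set} {X Y : Mat A n} → (∀ i j → entry X i j ≡ entry Y i j) → X ≡ Y
  Mat-ext {X = X} {Y} eq = Vec-ext X Y λ i → Vec-ext (lookup X i) (lookup Y i) (eq i)
    where
    Vec-ext : ∀ {A : Set} (xs ys : Vec A n) → (∀ i → lookup xs i ≡ lookup ys i) → xs ≡ ys
    Vec-ext xs ys eq =
      trans (sym (VecP.tabulate∘lookup xs)) (trans (VecP.tabulate-cong eq) (VecP.tabulate∘lookup ys))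

dot : ∀ {k} → Vec ℚ k → Vec ℚ k → ℚ
dot r s = sumℚ (zipWith ℚ._*_ r s)

dot-affine : ∀ λ₁ λ₂ {k} (c x a b d : Vec ℚ k) →
  (∀ i → lookup x i ≡ affine λ₁ λ₂ (lookup a i) (lookup b i) (lookup d i)) →
  dot c x ≡ affine λ₁ λ₂ (dot c a) (dot c b) (dot c d)
dot-affine λ₁ λ₂ [] [] [] [] [] eq = sym (affine-const λ₁ λ₂ 0ℚ)
dot-affine λ₁ λ₂ (c ∷ cs) (x ∷ xs) (a ∷ as) (b ∷ bs) (d ∷ ds) eq = begin
  c ℚ.* x ℚ.+ dot cs xs
    ≡⟨ cong₂ ℚ._+_ (trans (cong (c ℚ.*_) (eq zero)) (affine-* λ₁ λ₂ c a b d))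
                   (dot-affine λ₁ λ₂ cs xs as bs ds (eq ∘ suc)) ⟩
  affine λ₁ λ₂ (c ℚ.* a) (c ℚ.* b) (c ℚ.* d) ℚ.+ affine λ₁ λ₂ (dot cs as) (dot cs bs) (dot cs ds)
    ≡⟨ affine-+ λ₁ λ₂ (c ℚ.* a) (c ℚ.* b) (c ℚ.* d) _ _ _ ⟩
  affine λ₁ λ₂ (dot (c ∷ cs) (a ∷ as)) (dot (c ∷ cs) (b ∷ bs)) (dot (c ∷ cs) (d ∷ ds))
    ∎
  where open ≡-Reasoning

pairing-affine : ∀ λ₁ λ₂ {k m} (C X A B D : Vec (Vec ℚ k) m) →
  (∀ i j → lookup (lookup X i) j ≡
           affine λ₁ λ₂ (lookup (lookup A i) j) (lookup (lookup B i) j) (lookup (lookup D i) j)) →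
  sumℚ (zipWith dot C X) ≡
  affine λ₁ λ₂ (sumℚ (zipWith dot C A)) (sumℚ (zipWith dot C B)) (sumℚ (zipWith dot C D))
pairing-affine λ₁ λ₂ [] [] [] [] [] eq = sym (affine-const λ₁ λ₂ 0ℚ)
pairing-affine λ₁ λ₂ (c ∷ C) (x ∷ X) (a ∷ A) (b ∷ B) (d ∷ D) eq =
  trans (cong₂ ℚ._+_ (dot-affine λ₁ λ₂ c x a b d (eq zero)) (pairing-affine λ₁ λ₂ C X A B D (eq ∘ suc)))
        (affine-+ λ₁ λ₂ (dot c a) (dot c b) (dot c d) _ _ _)

-- The unit square

Corner : Set
Corner = ℤ × ℤ

_≟ᶜ_ : (u v : Corner) → Dec (u ≡ v)
_≟ᶜ_ = ProductP.≡-dec ℤ._≟_ ℤ._≟_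

corners : List Corner
corners = (+ 0 , + 0) ∷ (+ 0 , + 1) ∷ (+ 1 , + 0) ∷ (+ 1 , + 1) ∷ []

binary⇒corner : ∀ {x y} → Binary x → Binary y → (x , y) ∈ corners
binary⇒corner (inj₁ refl) (inj₁ refl) = here refl
binary⇒corner (inj₁ refl) (inj₂ refl) = there (here refl)
binary⇒corner (inj₂ refl) (inj₁ refl) = there (there (here refl))
binary⇒corner (inj₂ refl) (inj₂ refl) = there (there (there (here refl)))

affine² : ℤ → ℤ → Corner → Corner → Corner → Corner
affine² s t (u₁ , u₂) (v₁ , v₂) (w₁ , w₂) = affineℤ s t u₁ v₁ w₁ , affineℤ s t u₂ v₂ w₂

signs : List ℤ
signs = + 1 ∷ -[1+ 0 ] ∷ []

record SquareCompletion (u v w : Corner) : Set where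
  field
    fourth   : Corner
    s t      : ℤ
    fourth≡  : fourth ≡ affine² s t u v w
    unique   : Unique (u ∷ v ∷ w ∷ fourth ∷ [])
    complete : ∀ {x} → x ∈ corners → x ∈ u ∷ v ∷ w ∷ fourth ∷ []

private
  Completes : Corner → Corner → Corner → Corner → Set
  Completes u v w m = Unique (u ∷ v ∷ w ∷ m ∷ []) × All (_∈ u ∷ v ∷ w ∷ m ∷ []) corners ×
                      Any (λ s → Any (λ t → m ≡ affine² s t u v w) signs) signs

  completion-table : All (λ u → All (λ v → All (λ w →
                       Unique (u ∷ v ∷ w ∷ []) → Any (Completes u v w) corners) corners) corners) corners
  completion-table = Dec.from-yes (All.all? (λ u → All.all? (λ v → All.all? (λ w →
    unique? (u ∷ v ∷ w ∷ []) →-dec Any.any? (λ m →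
      unique? (u ∷ v ∷ w ∷ m ∷ []) ×-dec
      All.all? (_∈? u ∷ v ∷ w ∷ m ∷ []) corners ×-dec
      Any.any? (λ s → Any.any? (λ t → m ≟ᶜ affine² s t u v w) signs) signs)
    corners) corners) corners) corners)
    where
    open import Data.List.Relation.Unary.Unique.DecPropositional _≟ᶜ_ using (unique?)
    open import Data.List.Membership.DecPropositional _≟ᶜ_ using (_∈?_)

  toSquareCompletion : ∀ {u v w m} → Completes u v w m → SquareCompletion u v w
  toSquareCompletion {m = m} (unique , complete , st) with Any.satisfied st
  ... | s , t∈ with Any.satisfied t∈
  ...   | t , m≡ = record
    { fourth = m ; s = s ; t = t ; fourth≡ = m≡ ; unique = unique ; complete = All.lookup complete }

opaque
  squareCompletion : ∀ {u v w} → u ∈ corners → v ∈ corners → w ∈ corners →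
                     Unique (u ∷ v ∷ w ∷ []) → SquareCompletion u v w
  squareCompletion u∈ v∈ w∈ distinct = toSquareCompletion
    (proj₂ (Any.satisfied (All.lookup (All.lookup (All.lookup completion-table u∈) v∈) w∈ distinct)))

-- A two-dimensional face

enumeration-3-or-4 : ∀ {A : Set} {P : A → Set} {a b d z : A} → Unique (a ∷ b ∷ d ∷ z ∷ []) →
  P a → P b → P d → Dec (P z) → (∀ {x} → P x → x ∈ a ∷ b ∷ d ∷ z ∷ []) →
  Σ (List A) λ L → Unique L × ((x : A) → (x ∈ L) ⇔ P x) × ((length L ≡ 3) ⊎ (length L ≡ 4))
enumeration-3-or-4 uniq Pa Pb Pd (yes Pz) cover =
  _ , uniq , (λ x → mk⇔ (All.lookup (Pa ∷ Pb ∷ Pd ∷ Pz ∷ [])) cover) , inj₂ refl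
enumeration-3-or-4 {P = P} {a} {b} {d} {z} uniq Pa Pb Pd (no ¬Pz) cover =
  _ , UniqueP.take⁺ 3 uniq ,
  (λ x → mk⇔ (All.lookup (Pa ∷ Pb ∷ Pd ∷ [])) (λ Px → drop-z Px (cover Px))) , inj₁ refl
  where
  drop-z : ∀ {x} → P x → x ∈ a ∷ b ∷ d ∷ z ∷ [] → x ∈ a ∷ b ∷ d ∷ []
  drop-z Px (here x≡a)                          = here x≡a
  drop-z Px (there (here x≡b))                  = there (here x≡b)
  drop-z Px (there (there (here x≡d)))          = there (there (here x≡d))
  drop-z Px (there (there (there (here refl)))) = ⊥-elim (¬Pz Px)

module Face {n : ℕ} (c : Mat ℚ n) (a b d : Mat ℤ n)
  (a∈F : InFace c a) (b∈F : InFace c b) (d∈F : InFace c d)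
  (independent : LinIndep₂ (toℚ b ⊖ toℚ a) (toℚ d ⊖ toℚ a))
  (spanned : (x : Mat ℤ n) → InFace c x → ∃ λ λ₁ → ∃ λ λ₂ →
             (toℚ x ⊖ toℚ a) ≡ (λ₁ · (toℚ b ⊖ toℚ a)) ⊕ (λ₂ · (toℚ d ⊖ toℚ a)))
  where

  open import Algebra.Properties.Group ℚP.+-0-group using (∙-cancelˡ; identityʳ-unique; x∙y⁻¹≈ε⇒x≈y)

  aℚ bℚ dℚ : Fin n → Fin n → ℚ
  aℚ = entry (toℚ a)
  bℚ = entry (toℚ b)
  dℚ = entry (toℚ d)

  -- A record rather than a function type, so that the coordinates can be inferred from a proof.
  record OnPlane (λ₁ λ₂ : ℚ) (x : Mat ℤ n) : Set where
    constructor onPlane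
    field
      entry-affine : ∀ i j → entry (toℚ x) i j ≡ affine λ₁ λ₂ (aℚ i j) (bℚ i j) (dℚ i j)

  open OnPlane

  InPlane : Mat ℤ n → Set
  InPlane x = Σ ℚ λ λ₁ → Σ ℚ λ λ₂ → OnPlane λ₁ λ₂ x

  a-onPlane : OnPlane 0ℚ 0ℚ a
  a-onPlane = onPlane λ i j → sym (affine-origin (aℚ i j) (bℚ i j) (dℚ i j))

  b-onPlane : OnPlane 1ℚ 0ℚ b
  b-onPlane = onPlane λ i j → sym (affine-first (aℚ i j) (bℚ i j) (dℚ i j))

  d-onPlane : OnPlane 0ℚ 1ℚ d
  d-onPlane = onPlane λ i j → sym (affine-second (aℚ i j) (bℚ i j) (dℚ i j))

  face⊆plane : ∀ {x} → InFace c x → InPlane x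
  face⊆plane {x} x∈F with spanned x x∈F
  ... | λ₁ , λ₂ , x-a≡ = λ₁ , λ₂ , onPlane λ i j → begin
    entry (toℚ x) i j
      ≡⟨ a+[x-a] (aℚ i j) (entry (toℚ x) i j) ⟩
    aℚ i j ℚ.+ (entry (toℚ x) i j ℚ.- aℚ i j)
      ≡⟨ cong (aℚ i j ℚ.+_) (sym (entry-zipWith ℚ._-_ (toℚ x) (toℚ a) i j)) ⟩
    aℚ i j ℚ.+ entry (toℚ x ⊖ toℚ a) i j
      ≡⟨ cong (λ M → aℚ i j ℚ.+ entry M i j) x-a≡ ⟩
    aℚ i j ℚ.+ entry ((λ₁ · (toℚ b ⊖ toℚ a)) ⊕ (λ₂ · (toℚ d ⊖ toℚ a))) i j
      ≡⟨ cong (aℚ i j ℚ.+_) (entry-combination λ₁ λ₂ (toℚ a) (toℚ b) (toℚ d) i j) ⟩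
    affine λ₁ λ₂ (aℚ i j) (bℚ i j) (dℚ i j)
      ∎
    where
    open ≡-Reasoning
    a+[x-a] : ∀ a x → x ≡ a ℚ.+ (x ℚ.- a)
    a+[x-a] = solve 2 (λ a x → x := a :+ (x :- a)) refl

  onPlane-injective : ∀ {λ₁ λ₂ x y} → OnPlane λ₁ λ₂ x → OnPlane λ₁ λ₂ y → x ≡ y
  onPlane-injective {λ₁} {λ₂} {x} {y} onx ony = Mat-ext λ i j → ι-injective (begin
    ι (entry x i j)                              ≡⟨ sym (entry-toℚ x i j) ⟩
    entry (toℚ x) i j                            ≡⟨ entry-affine onx i j ⟩
    affine λ₁ λ₂ (aℚ i j) (bℚ i j) (dℚ i j)      ≡⟨ sym (entry-affine ony i j) ⟩
    entry (toℚ y) i j                            ≡⟨ entry-toℚ y i j ⟩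
    ι (entry y i j)                              ∎)
    where open ≡-Reasoning

  plane∩ASM⊆face : ∀ {x} → InPlane x → IsASM x → InFace c x
  plane∩ASM⊆face {x} (λ₁ , λ₂ , on) asm =
    asm , λ B asmB → subst (⟨ c , toℚ B ⟩ ℚ.≤_) (sym value) (proj₂ a∈F B asmB)
    where
    same-value : ∀ {y} → InFace c y → ⟨ c , toℚ y ⟩ ≡ ⟨ c , toℚ a ⟩
    same-value y∈F = ℚP.≤-antisym (proj₂ a∈F _ (proj₁ y∈F)) (proj₂ y∈F a (proj₁ a∈F))
    value : ⟨ c , toℚ x ⟩ ≡ ⟨ c , toℚ a ⟩
    value = begin
      ⟨ c , toℚ x ⟩
        ≡⟨ pairing-affine λ₁ λ₂ c (toℚ x) (toℚ a) (toℚ b) (toℚ d) (entry-affine on) ⟩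
      affine λ₁ λ₂ ⟨ c , toℚ a ⟩ ⟨ c , toℚ b ⟩ ⟨ c , toℚ d ⟩
        ≡⟨ affine-cong λ₁ λ₂ (refl {x = ⟨ c , toℚ a ⟩}) (same-value b∈F) (same-value d∈F) ⟩
      affine λ₁ λ₂ ⟨ c , toℚ a ⟩ ⟨ c , toℚ a ⟩ ⟨ c , toℚ a ⟩
        ≡⟨ affine-const λ₁ λ₂ ⟨ c , toℚ a ⟩ ⟩
      ⟨ c , toℚ a ⟩
        ∎
      where open ≡-Reasoning

  φ : Mat ℤ n → Pos n → ℚ
  φ x (i , j) = prefixSum ℚ._+_ (entry (toℚ x) i) j

  φ-onPlane : ∀ {λ₁ λ₂ x} → OnPlane λ₁ λ₂ x → ∀ r → φ x r ≡ affine λ₁ λ₂ (φ a r) (φ b r) (φ d r)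
  φ-onPlane {λ₁} {λ₂} on (i , j) = prefixSum-affine λ₁ λ₂ (entry-affine on i) j

  φ≡ι∘rowPartialSum : ∀ x r → φ x r ≡ ι (rowPartialSum x r)
  φ≡ι∘rowPartialSum x (i , j) =
    trans (prefixSum-cong ℚ._+_ (entry-toℚ x i) j) (prefixSum-homo ι ι-+ (entry x i) j)

  u v : Pos n → ℚ
  u r = φ b r ℚ.- φ a r
  v r = φ d r ℚ.- φ a r

  φ-independent : Independent u v
  φ-independent α β αu+βv≡0 = independent α β (Mat-ext λ i j → begin
    entry ((α · (toℚ b ⊖ toℚ a)) ⊕ (β · (toℚ d ⊖ toℚ a))) i j
      ≡⟨ entry-combination α β (toℚ a) (toℚ b) (toℚ d) i j ⟩
    α ℚ.* (bℚ i j ℚ.- aℚ i j) ℚ.+ β ℚ.* (dℚ i j ℚ.- aℚ i j)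
      ≡⟨ identityʳ-unique (aℚ i j) _ (row-fixed i j) ⟩
    0ℚ
      ≡⟨ sym (entry-zeroM i j) ⟩
    entry zeroM i j
      ∎)
    where
    open ≡-Reasoning
    row-fixed : ∀ i j → affine α β (aℚ i j) (bℚ i j) (dℚ i j) ≡ aℚ i j
    row-fixed i = prefixSum-injective ℚ._+_ ∙-cancelˡ λ j → begin
      prefixSum ℚ._+_ (λ k → affine α β (aℚ i k) (bℚ i k) (dℚ i k)) j
        ≡⟨ prefixSum-affine α β (λ _ → refl) j ⟩
      φ a (i , j) ℚ.+ (α ℚ.* u (i , j) ℚ.+ β ℚ.* v (i , j))
        ≡⟨ cong (φ a (i , j) ℚ.+_) (αu+βv≡0 (i , j)) ⟩
      φ a (i , j) ℚ.+ 0ℚ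
        ≡⟨ ℚP.+-identityʳ _ ⟩
      φ a (i , j)
        ∎

  nonzero-minor : ∃₂ λ p q → minor u v p q ≢ 0ℚ
  nonzero-minor = independent⇒nonzero-minor (searchable-× FinP.any? FinP.any?) φ-independent

  p q : Pos n
  p = proj₁ nonzero-minor
  q = proj₁ (proj₂ nonzero-minor)

  code : Mat ℤ n → Corner
  code x = rowPartialSum x p , rowPartialSum x q

  coordinate-difference : ∀ {λ₁ λ₂ μ₁ μ₂ x y} → OnPlane λ₁ λ₂ x → OnPlane μ₁ μ₂ y →
    ∀ r → rowPartialSum x r ≡ rowPartialSum y r → (λ₁ ℚ.- μ₁) ℚ.* u r ℚ.+ (λ₂ ℚ.- μ₂) ℚ.* v r ≡ 0ℚ
  coordinate-difference {λ₁} {λ₂} {μ₁} {μ₂} {x} {y} onx ony r σ≡ =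
    identityʳ-unique (affine μ₁ μ₂ (φ a r) (φ b r) (φ d r)) _ (begin
      affine μ₁ μ₂ (φ a r) (φ b r) (φ d r) ℚ.+ ((λ₁ ℚ.- μ₁) ℚ.* u r ℚ.+ (λ₂ ℚ.- μ₂) ℚ.* v r)
        ≡⟨ sym (affine-shift λ₁ λ₂ μ₁ μ₂ (φ a r) (φ b r) (φ d r)) ⟩
      affine λ₁ λ₂ (φ a r) (φ b r) (φ d r)
        ≡⟨ sym (φ-onPlane onx r) ⟩
      φ x r
        ≡⟨ trans (φ≡ι∘rowPartialSum x r) (trans (cong ι σ≡) (sym (φ≡ι∘rowPartialSum y r))) ⟩
      φ y r
        ≡⟨ φ-onPlane ony r ⟩
      affine μ₁ μ₂ (φ a r) (φ b r) (φ d r)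
        ∎)
    where open ≡-Reasoning

  coordinates-unique : ∀ {λ₁ λ₂ μ₁ μ₂ x y} → OnPlane λ₁ λ₂ x → OnPlane μ₁ μ₂ y →
                       code x ≡ code y → λ₁ ≡ μ₁ × λ₂ ≡ μ₂
  coordinates-unique {λ₁} {λ₂} {μ₁} {μ₂} onx ony code≡ =
    Product.map (x∙y⁻¹≈ε⇒x≈y λ₁ μ₁) (x∙y⁻¹≈ε⇒x≈y λ₂ μ₂)
      (det≢0⇒trivial-solution (proj₂ (proj₂ nonzero-minor))
        (coordinate-difference onx ony p (cong proj₁ code≡))
        (coordinate-difference onx ony q (cong proj₂ code≡)))

  code-injective : ∀ {x y} → InPlane x → InPlane y → code x ≡ code y → x ≡ y
  code-injective {x} {y} (λ₁ , λ₂ , onx) (μ₁ , μ₂ , ony) code≡ =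
    onPlane-injective onx (subst₂ (λ α β → OnPlane α β y) (sym (proj₁ same)) (sym (proj₂ same)) ony)
    where
    same : λ₁ ≡ μ₁ × λ₂ ≡ μ₂
    same = coordinates-unique onx ony code≡

  code∈corners : ∀ {x} → InFace c x → code x ∈ corners
  code∈corners (asm , _) = binary⇒corner (rowPartialSum-binary asm p) (rowPartialSum-binary asm q)

  codes-distinct : Unique (code a ∷ code b ∷ code d ∷ [])
  codes-distinct =
      ((λ eq → ℚP.1≢0 (sym (proj₁ (coordinates-unique a-onPlane b-onPlane eq))))
    ∷ (λ eq → ℚP.1≢0 (sym (proj₂ (coordinates-unique a-onPlane d-onPlane eq)))) ∷ [])
    ∷ ((λ eq → ℚP.1≢0 (proj₁ (coordinates-unique b-onPlane d-onPlane eq))) ∷ [])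
    ∷ [] ∷ []

  open SquareCompletion
    (squareCompletion (code∈corners a∈F) (code∈corners b∈F) (code∈corners d∈F) codes-distinct)

  z : Mat ℤ n
  z = matrix λ i j → affineℤ s t (entry a i j) (entry b i j) (entry d i j)

  z-onPlane : OnPlane (ι s) (ι t) z
  z-onPlane = onPlane λ i j → begin
    entry (toℚ z) i j
      ≡⟨ entry-toℚ z i j ⟩
    ι (entry z i j)
      ≡⟨ cong ι (entry-matrix (λ i j → affineℤ s t (entry a i j) (entry b i j) (entry d i j)) i j) ⟩
    ι (affineℤ s t (entry a i j) (entry b i j) (entry d i j))
      ≡⟨ ι-affine s t (entry a i j) (entry b i j) (entry d i j) ⟩
    affine (ι s) (ι t) (ι (entry a i j)) (ι (entry b i j)) (ι (entry d i j))
      ≡⟨ sym (affine-cong (ι s) (ι t) (entry-toℚ a i j) (entry-toℚ b i j) (entry-toℚ d i j)) ⟩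
    affine (ι s) (ι t) (aℚ i j) (bℚ i j) (dℚ i j)
      ∎
    where open ≡-Reasoning

  code-z : code z ≡ fourth
  code-z = trans (cong₂ _,_ (σ-z p) (σ-z q)) (sym fourth≡)
    where
    σ-z : ∀ r → rowPartialSum z r ≡ affineℤ s t (rowPartialSum a r) (rowPartialSum b r) (rowPartialSum d r)
    σ-z r = ι-injective (begin
      ι (rowPartialSum z r)
        ≡⟨ sym (φ≡ι∘rowPartialSum z r) ⟩
      φ z r
        ≡⟨ φ-onPlane z-onPlane r ⟩
      affine (ι s) (ι t) (φ a r) (φ b r) (φ d r)
        ≡⟨ affine-cong (ι s) (ι t) (φ≡ι∘rowPartialSum a r) (φ≡ι∘rowPartialSum b r) (φ≡ι∘rowPartialSum d r) ⟩
      affine (ι s) (ι t) (ι (rowPartialSum a r)) (ι (rowPartialSum b r)) (ι (rowPartialSum d r))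
        ≡⟨ sym (ι-affine s t (rowPartialSum a r) (rowPartialSum b r) (rowPartialSum d r)) ⟩
      ι (affineℤ s t (rowPartialSum a r) (rowPartialSum b r) (rowPartialSum d r))
        ∎)
      where open ≡-Reasoning

  vertices : List (Mat ℤ n)
  vertices = a ∷ b ∷ d ∷ z ∷ []

  codes : List.map code vertices ≡ code a ∷ code b ∷ code d ∷ fourth ∷ []
  codes = cong (λ m → code a ∷ code b ∷ code d ∷ m ∷ []) code-z

  vertices-unique : Unique vertices
  vertices-unique = UniqueP.map⁻ {f = code} (subst Unique (sym codes) unique)

  vertices-inPlane : All InPlane vertices
  vertices-inPlane =
    (_ , _ , a-onPlane) ∷ (_ , _ , b-onPlane) ∷ (_ , _ , d-onPlane) ∷ (_ , _ , z-onPlane) ∷ []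

  face⊆vertices : ∀ {x} → InFace c x → x ∈ vertices
  face⊆vertices {x} x∈F = via (∈-map⁻ code (subst (code x ∈_) (sym codes) (complete (code∈corners x∈F))))
    where
    via : (∃ λ y → y ∈ vertices × code x ≡ code y) → x ∈ vertices
    via (y , y∈vertices , code≡) = subst (_∈ vertices) (sym x≡y) y∈vertices
      where
      x≡y : x ≡ y
      x≡y = code-injective (face⊆plane x∈F) (All.lookup vertices-inPlane y∈vertices) code≡

  inFace? : Dec (InFace c z)
  inFace? = Dec.map′ (plane∩ASM⊆face (_ , _ , z-onPlane)) proj₁ (isASM? z)

mainTheorem11 : (n : ℕ) (c : Mat ℚ n) → AffDim2 (InFace c) →
    Σ (List (Mat ℤ n)) λ L →
      Unique L × ((A : Mat ℤ n) → (A ∈ L) ⇔ InFace c A) × ((length L ≡ 3) ⊎ (length L ≡ 4))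
mainTheorem11 n c (a , b , d , a∈F , b∈F , d∈F , independent , spanned) =
  enumeration-3-or-4 vertices-unique a∈F b∈F d∈F inFace? face⊆vertices
  where open Face c a b d a∈F b∈F d∈F independent spanned
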